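{- Let $W$ be a set with a reflexive and symmetric binary relation $R$, and let $B$ be a family of subsets of $W$ containing $\emptyset$ and $W$ and closed under $\cup$. Define on $B$: $0=\emptyset$, $1=W$, $a+b=a\cup b$, $a\leq b$ iff $a\subseteq b$, and $aCb$ iff there exist $U\in a$ and $V\in b$ with $URV$. If $(B,\leq,0,1,+,C)$ satisfies axiom (ad), then it is a distributive contact join-semilattice.
   Context: Axiom (ad): for all $x,a,b$, if $x\leq a+b$ then there exist $a'\leq a$ and $b'\leq b$ with $x=a'+b'$. A distributive contact join-semilattice (DCJS) is a structure $(B,\leq,0,1,+,C)$ satisfying for all elements: (1) $x\leq x$; (2) $x\leq y\wedge y\leq x\rightarrow x=y$; (3) $x\leq y\wedge y\leq z\rightarrow x\leq z$; (4) $x+y=y+x$; (5) $x\leq x+y$; (6) $x\leq z\wedge y\leq z\rightarrow x+y\leq z$; (7) $0\leq x$; (8) $x\leq 1$; (9) $xCy\rightarrow x\neq 0$; (10) $xCy\rightarrow yCx$; (11) $xC(y+z)\rightarrow xCy$ or $xCz$; (12) $xCy\wedge y\leq y'\rightarrow xCy'$; (13) $x\neq 0\rightarrow xCx$; and (ad). -}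

module Defs where

open import Level using (Level; 0ℓ)
open import Data.Product using (Σ; ∃; _×_; _,_; proj₁)
open import Data.Sum using (_⊎_)
open import Relation.Nullary using (¬_)
open import Relation.Unary using (Pred; _∈_; _⊆_; _∪_; ∅; U)
open import Relation.Binary using (Rel; Reflexive; Symmetric)

AD : (B : Set₁) (_≈_ _≤_ : B → B → Set) (_+_ : B → B → B) → Set₁
AD B _≈_ _≤_ _+_ =
  ∀ x a b → x ≤ (a + b) →
    Σ B λ a′ → Σ B λ b′ → (a′ ≤ a) × (b′ ≤ b) × (x ≈ (a′ + b′))

record IsDCJS (B : Set₁) (_≈_ : B → B → Set) (_≤_ : B → B → Set)
              (𝟘 𝟙 : B) (_+_ : B → B → B) (_C_ : B → B → Set) : Set₁ where
  field
    refl≤    : ∀ x → x ≤ x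
    antisym  : ∀ x y → x ≤ y → y ≤ x → x ≈ y
    trans≤   : ∀ x y z → x ≤ y → y ≤ z → x ≤ z
    +-comm   : ∀ x y → (x + y) ≈ (y + x)
    +-upperˡ : ∀ x y → x ≤ (x + y)
    +-lub    : ∀ x y z → x ≤ z → y ≤ z → (x + y) ≤ z
    𝟘-least  : ∀ x → 𝟘 ≤ x
    𝟙-great  : ∀ x → x ≤ 𝟙
    C-nonzero : ∀ x y → x C y → ¬ (x ≈ 𝟘)
    C-sym    : ∀ x y → x C y → y C x
    C-split  : ∀ x y z → x C (y + z) → (x C y) ⊎ (x C z)
    C-mono   : ∀ x y y′ → x C y → y ≤ y′ → x C y′
    C-refl   : ∀ x → ¬ (x ≈ 𝟘) → x C x
    ad       : AD B _≈_ _≤_ _+_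

module Induced {W : Set} (R : Rel W 0ℓ) (InB : Pred (Pred W 0ℓ) 0ℓ)
               (∅∈B : ∅ ∈ InB) (W∈B : U ∈ InB)
               (∪∈B : ∀ {a b} → a ∈ InB → b ∈ InB → (a ∪ b) ∈ InB) where

  Elt : Set₁
  Elt = Σ (Pred W 0ℓ) InB

  _≤ᴮ_ : Elt → Elt → Set
  a ≤ᴮ b = proj₁ a ⊆ proj₁ b

  _≈ᴮ_ : Elt → Elt → Set
  a ≈ᴮ b = (a ≤ᴮ b) × (b ≤ᴮ a)

  0ᴮ : Elt
  0ᴮ = ∅ , ∅∈B

  1ᴮ : Elt
  1ᴮ = U , W∈B

  _+ᴮ_ : Elt → Elt → Elt
  (a , p) +ᴮ (b , q) = (a ∪ b) , ∪∈B p q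

  _Cᴮ_ : Elt → Elt → Set
  a Cᴮ b = Σ W λ u → Σ W λ v → (u ∈ proj₁ a) × (v ∈ proj₁ b) × R u v

module Submission where

open import Defs
open import Level using (0ℓ)
open import Axiom.ExcludedMiddle using (ExcludedMiddle)
open import Axiom.DoubleNegationElimination using (em⇒dne)
open import Relation.Unary using (Pred; _∈_; _∪_; ∅; U; Empty; Satisfiable)
open import Relation.Unary.Properties using (∅-⊆; ⊆-U; ⊆-trans)
open import Relation.Unary.Algebra using (∪-comm)
open import Relation.Binary using (Rel; Reflexive; Symmetric)
open import Data.Product using (_,_; proj₁)
open import Data.Sum using (_⊎_; inj₁; inj₂; [_,_])
open import Relation.Nullary using (¬_)

module InducedProperties {W : Set} (R : Rel W 0ℓ) (InB : Pred (Pred W 0ℓ) 0ℓ)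
                         (∅∈B : ∅ ∈ InB) (W∈B : U ∈ InB)
                         (∪∈B : ∀ {a b} → a ∈ InB → b ∈ InB → (a ∪ b) ∈ InB) where

  open Induced R InB ∅∈B W∈B ∪∈B

  ≤ᴮ-refl : ∀ a → a ≤ᴮ a
  ≤ᴮ-refl a w∈a = w∈a

  ≤ᴮ-antisym : ∀ a b → a ≤ᴮ b → b ≤ᴮ a → a ≈ᴮ b
  ≤ᴮ-antisym a b = _,_

  ≤ᴮ-trans : ∀ a b c → a ≤ᴮ b → b ≤ᴮ c → a ≤ᴮ c
  ≤ᴮ-trans a b c = ⊆-trans

  +ᴮ-comm : ∀ a b → (a +ᴮ b) ≈ᴮ (b +ᴮ a)
  +ᴮ-comm a b = ∪-comm (proj₁ a) (proj₁ b)

  +ᴮ-upperˡ : ∀ a b → a ≤ᴮ (a +ᴮ b)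
  +ᴮ-upperˡ a b = inj₁

  +ᴮ-lub : ∀ a b c → a ≤ᴮ c → b ≤ᴮ c → (a +ᴮ b) ≤ᴮ c
  +ᴮ-lub a b c a≤c b≤c = [ a≤c , b≤c ]

  0ᴮ-least : ∀ a → 0ᴮ ≤ᴮ a
  0ᴮ-least a = ∅-⊆ (proj₁ a)

  1ᴮ-greatest : ∀ a → a ≤ᴮ 1ᴮ
  1ᴮ-greatest a = ⊆-U (proj₁ a)

  Cᴮ-nonzero : ∀ a b → a Cᴮ b → ¬ (a ≈ᴮ 0ᴮ)
  Cᴮ-nonzero a b (u , v , u∈a , v∈b , uRv) (a≤0 , 0≤a) = a≤0 u∈a

  Cᴮ-sym : Symmetric R → ∀ a b → a Cᴮ b → b Cᴮ a
  Cᴮ-sym sym a b (u , v , u∈a , v∈b , uRv) = v , u , v∈b , u∈a , sym uRv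

  Cᴮ-split : ∀ a b c → a Cᴮ (b +ᴮ c) → (a Cᴮ b) ⊎ (a Cᴮ c)
  Cᴮ-split a b c (u , v , u∈a , inj₁ v∈b , uRv) = inj₁ (u , v , u∈a , v∈b , uRv)
  Cᴮ-split a b c (u , v , u∈a , inj₂ v∈c , uRv) = inj₂ (u , v , u∈a , v∈c , uRv)

  Cᴮ-monoʳ : ∀ a b b′ → a Cᴮ b → b ≤ᴮ b′ → a Cᴮ b′
  Cᴮ-monoʳ a b b′ (u , v , u∈a , v∈b , uRv) b≤b′ = u , v , u∈a , b≤b′ v∈b , uRv

  empty⇒≈ᴮ0ᴮ : ∀ a → Empty (proj₁ a) → a ≈ᴮ 0ᴮ
  empty⇒≈ᴮ0ᴮ a a-empty = (λ {w} → a-empty w) , ∅-⊆ (proj₁ a)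

  -- The only non-constructive step: a subset not equal to ∅ has a point.
  nonzero⇒satisfiable : ExcludedMiddle 0ℓ → ∀ a → ¬ (a ≈ᴮ 0ᴮ) → Satisfiable (proj₁ a)
  nonzero⇒satisfiable em a a≉0 =
    em⇒dne em λ ∄w → a≉0 (empty⇒≈ᴮ0ᴮ a λ w w∈a → ∄w (w , w∈a))

  Cᴮ-refl : ExcludedMiddle 0ℓ → Reflexive R → ∀ a → ¬ (a ≈ᴮ 0ᴮ) → a Cᴮ a
  Cᴮ-refl em refl a a≉0 with nonzero⇒satisfiable em a a≉0
  ... | u , u∈a = u , u , u∈a , u∈a , refl

mainTheorem12 : ExcludedMiddle 0ℓ → {W : Set} (R : Rel W 0ℓ) → Reflexive R → Symmetric R →
    (InB : Pred (Pred W 0ℓ) 0ℓ) (∅∈B : ∅ ∈ InB) (W∈B : U ∈ InB)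
    (∪∈B : ∀ {a b} → a ∈ InB → b ∈ InB → (a ∪ b) ∈ InB) →
    let open Induced R InB ∅∈B W∈B ∪∈B in
    AD Elt _≈ᴮ_ _≤ᴮ_ _+ᴮ_ →
    IsDCJS Elt _≈ᴮ_ _≤ᴮ_ 0ᴮ 1ᴮ _+ᴮ_ _Cᴮ_
mainTheorem12 em R refl sym InB ∅∈B W∈B ∪∈B ad = record
  { refl≤     = ≤ᴮ-refl
  ; antisym   = ≤ᴮ-antisym
  ; trans≤    = ≤ᴮ-trans
  ; +-comm    = +ᴮ-comm
  ; +-upperˡ  = +ᴮ-upperˡ
  ; +-lub     = +ᴮ-lub
  ; 𝟘-least   = 0ᴮ-least
  ; 𝟙-great   = 1ᴮ-greatest
  ; C-nonzero = Cᴮ-nonzero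
  ; C-sym     = Cᴮ-sym sym
  ; C-split   = Cᴮ-split
  ; C-mono    = Cᴮ-monoʳ
  ; C-refl    = Cᴮ-refl em refl
  ; ad        = ad
  }
  where open InducedProperties R InB ∅∈B W∈B ∪∈B
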